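{- For every integer $k\geq 1$, every $\epsilon>0$, and every function $\sigma\colon\mathbb N\to (0,1)$, there is a constant $N=N(k,\epsilon,\sigma)$ (depending only on $k,\epsilon,\sigma$) such that for any finite $k$-stable graph $(V,E)$ with $V\neq\emptyset$, there is a partition $V=X_0\cup X_1\cup\ldots\cup X_m$ with $m\leq N$ such that $|X_0|<\epsilon|V|$ and, for all $i\geq 1$, $X_i$ is $\sigma(m)$-good in $(V,E)$.
   Context: A graph $(V,E)$ is $k$-stable if there do not exist $v_1,\ldots,v_k,w_1,\ldots,w_k\in V$ such that $E(v_i,w_j)$ holds if and only if $i\leq j$. For $X\subseteq V$ and $b\in V$, $E(X,b)$ denotes the set of $a\in X$ with $E(a,b)$. A set $X\subseteq V$ is $\gamma$-good in $(V,E)$ if for all $b\in V$, either $|E(X,b)|<\gamma|X|$ or $|E(X,b)|>(1-\gamma)|X|$.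
   Formalization: The parameter ε is a positive rational, and the function σ takes values in the rationals strictly between 0 and 1. -}

module Defs where

open import Data.Nat using (ℕ; zero; suc)
open import Data.Bool using (Bool; true; false)
open import Data.Fin using (Fin; toℕ) renaming (_≤_ to _≤ᶠ_)
open import Data.Fin using (_≟_)
open import Data.List using (List; filter; length; allFin)
open import Data.Integer using (+_)
open import Data.Rational using (ℚ; _/_; _<_; _*_; _-_; 1ℚ)
open import Data.Product using (Σ; _×_)
open import Data.Sum using (_⊎_)
open import Relation.Nullary using (¬_; does)
open import Relation.Unary using (Pred)
open import Relation.Binary.PropositionalEquality using (_≡_)

Graph : ℕ → Set
Graph n = Fin n → Fin n → Bool

Symmetric : ∀ {n} → Graph n → Set
Symmetric {n} E = (a b : Fin n) → E a b ≡ E b a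

Irreflexive : ∀ {n} → Graph n → Set
Irreflexive {n} E = (a : Fin n) → E a a ≡ false

Stable : ℕ → ∀ {n} → Graph n → Set
Stable k {n} E =
  ¬ Σ (Fin k → Fin n) λ v → Σ (Fin k → Fin n) λ w →
      (i j : Fin k) → ((E (v i) (w j) ≡ true → i ≤ᶠ j) × (i ≤ᶠ j → E (v i) (w j) ≡ true))

Subset : ℕ → Set
Subset n = Fin n → Bool

card : ∀ {n} → Subset n → ℕ
card {n} X = length (filter (λ a → X a Data.Bool.≟ true) (allFin n))

ℕtoℚ : ℕ → ℚ
ℕtoℚ m = (+ m) / 1

nbhdIn : ∀ {n} → Graph n → Subset n → Fin n → Subset n
nbhdIn E X b a = X a Data.Bool.∧ E a b

Good : ∀ {n} → ℚ → Graph n → Subset n → Set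
Good {n} γ E X = (b : Fin n) →
  (ℕtoℚ (card (nbhdIn E X b)) < γ * ℕtoℚ (card X))
  ⊎ ((1ℚ - γ) * ℕtoℚ (card X) < ℕtoℚ (card (nbhdIn E X b)))

part : ∀ {n m} → (Fin n → Fin m) → Fin m → Subset n
part f i a = does (f a ≟ i)

{-# OPTIONS --safe #-}
module Submission where

-- A set is shattered to depth d + 1 if some vertex splits it into a neighbourhood part and a
-- non-neighbourhood part that are both shattered to depth d.  A Ramsey argument turns a deep
-- enough splitting tree into a half graph, so a k-stable graph does not shatter its vertex set
-- to depth ladderDepth k (k + 1).
--
-- The decomposition is by induction on the depth.  Given at most P disjoint sets of total size u,
-- none shattered to depth r + 1, repeatedly carve out of what is left of them halves of size
-- ≥ u / c that are not shattered to depth r, and decompose these pieces by induction.  On the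
-- uncarved rest the traces of the original sets are good or small: were a large trace split by
-- a vertex into two large halves, these would be shattered to depth r (or they would have been
-- carved), so the original set would be shattered to depth r + 1.  The threshold c has to beat
-- the number of parts the induction produces from up to c pieces; this circularity is broken
-- by K + 1 stages with increasing thresholds, one of which carves away less than u / K.

module RunningMaximum where

  open import Data.Nat using (ℕ; zero; suc; _≤_; _⊔_; s≤s⁻¹)
  open import Data.Nat.Properties using (≤-refl; ≤-trans; m≤m⊔n; m≤n⊔m; m≤n⇒m<n∨m≡n)
  open import Data.Sum using (inj₁; inj₂)
  open import Relation.Binary using (_Preserves_⟶_)
  open import Relation.Binary.PropositionalEquality using (refl)

  maxUpTo : (ℕ → ℕ) → ℕ → ℕ
  maxUpTo f zero = f zero
  maxUpTo f (suc m) = maxUpTo f m ⊔ f (suc m)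

  maxUpTo-mono : ∀ f → maxUpTo f Preserves _≤_ ⟶ _≤_
  maxUpTo-mono f {m} {zero} m≤0 with m≤n⇒m<n∨m≡n m≤0
  ... | inj₂ refl = ≤-refl
  maxUpTo-mono f {m} {suc m′} m≤m′+1 with m≤n⇒m<n∨m≡n m≤m′+1
  ... | inj₁ m<m′+1 = ≤-trans (maxUpTo-mono f (s≤s⁻¹ m<m′+1)) (m≤m⊔n _ _)
  ... | inj₂ refl = ≤-refl

  ≤-maxUpTo : ∀ f {s m} → s ≤ m → f s ≤ maxUpTo f m
  ≤-maxUpTo f {zero} s≤m = maxUpTo-mono f {0} s≤m
  ≤-maxUpTo f {suc s} s≤m = ≤-trans (m≤n⊔m (maxUpTo f s) _) (maxUpTo-mono f s≤m)

module ListProperties where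

  open import Data.List using (List; _∷_; filter)
  open import Data.List.Relation.Unary.Any using (Any; here; there)
  open import Data.Sum using (_⊎_; inj₁; inj₂; map₁; map₂)
  open import Function using (_∘_)
  open import Relation.Nullary using (yes; no; ¬?)
  open import Relation.Unary using (Decidable)

  Any-filter-⊎ : ∀ {A : Set} {P Q : A → Set} (Q? : Decidable Q) {xs : List A} →
    Any P xs → Any P (filter Q? xs) ⊎ Any P (filter (¬? ∘ Q?) xs)
  Any-filter-⊎ Q? {x ∷ xs} (here px) with Q? x
  ... | yes _ = inj₁ (here px)
  ... | no _ = inj₂ (here px)
  Any-filter-⊎ Q? {x ∷ xs} (there p) with Q? x
  ... | yes _ = map₁ there (Any-filter-⊎ Q? p)
  ... | no _ = map₂ there (Any-filter-⊎ Q? p)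

module FiniteSets where

  open import Defs using (Subset; card)
  open import Data.Bool using (true; false; T; not; _∧_; _∨_; if_then_else_; _≟_)
  open import Data.Bool.Properties using (T-∧; T-∨)
  open import Data.Empty using (⊥; ⊥-elim)
  open import Data.Fin using (Fin; zero; suc)
  open import Data.List using (List; []; _∷_; length; filter; tabulate; foldr)
  open import Data.List.Relation.Unary.All using (All; []; _∷_; lookupWith)
  open import Data.List.Relation.Unary.AllPairs using (AllPairs; []; _∷_)
  open import Data.List.Relation.Unary.Any using (Any; here; there)
  open import Data.Nat using (ℕ; zero; suc; _+_; _*_; _≤_; _<_; z≤n; s≤s)
  open import Data.Nat.Properties
    using (+-suc; ≤-trans; ≤-reflexive; ≤-antisym; n≤1+n; m≤n⇒m≤1+n; +-mono-≤; +-monoʳ-≤; *-monoʳ-≤;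
           *-zeroʳ; *-distribˡ-+; module ≤-Reasoning)
  open import Data.Product using (∃; _×_; _,_; proj₁; proj₂; map₂)
  open import Data.Sum using (_⊎_; inj₁; inj₂)
  open import Data.Unit using (tt)
  open import Function using (_∘_; Equivalence)
  open import Relation.Nullary using (¬_; Dec; T?)
  open import Relation.Binary.PropositionalEquality using (_≡_; refl; cong; sym; trans; subst; module ≡-Reasoning)

  open Equivalence using (to; from)

  private variable
    n : ℕ
    a : Fin n
    X Y Z : Subset n

  infix 4 _∈_ _∉_ _⊆_
  infixl 7 _∩_
  infixl 6 _∪_ _∖_

  -- Opaque, so that unification recovers X and Y from types such as a ∈ X ∩ Y.
  opaque
    _∈_ : Fin n → Subset n → Set
    a ∈ X = T (X a)

    ∅ full : Subset n
    ∅ _ = false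
    full _ = true

    _∩_ _∪_ _∖_ : Subset n → Subset n → Subset n
    (X ∩ Y) a = X a ∧ Y a
    (X ∪ Y) a = X a ∨ Y a
    (X ∖ Y) a = X a ∧ not (Y a)

    ∣_∣ : Subset n → ℕ
    ∣_∣ {zero} X = 0
    ∣_∣ {suc n} X = if X zero then suc ∣ X ∘ suc ∣ else ∣ X ∘ suc ∣

  _∉_ : Fin n → Subset n → Set
  a ∉ X = ¬ a ∈ X

  _⊆_ : Subset n → Subset n → Set
  X ⊆ Y = ∀ {a} → a ∈ X → a ∈ Y

  Disjoint : Subset n → Subset n → Set
  Disjoint X Y = ∀ {a} → a ∈ X → a ∈ Y → ⊥

  ⋃ : List (Subset n) → Subset n
  ⋃ = foldr _∪_ ∅

  opaque
    unfolding _∈_ ∅ full _∩_ _∪_ _∖_ ∣_∣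

    _∈?_ : (a : Fin n) (X : Subset n) → Dec (a ∈ X)
    a ∈? X = T? (X a)

    ∉∅ : a ∉ ∅
    ∉∅ ()

    ∈full : a ∈ full
    ∈full = tt

    ∈∩⁺ : a ∈ X → a ∈ Y → a ∈ X ∩ Y
    ∈∩⁺ p q = from T-∧ (p , q)

    ∈∩⁻ : a ∈ X ∩ Y → a ∈ X × a ∈ Y
    ∈∩⁻ = to T-∧

    ∈∪⁺ : a ∈ X ⊎ a ∈ Y → a ∈ X ∪ Y
    ∈∪⁺ = from T-∨

    ∈∪⁻ : a ∈ X ∪ Y → a ∈ X ⊎ a ∈ Y
    ∈∪⁻ = to T-∨

    ∈∖⁺ : a ∈ X → a ∉ Y → a ∈ X ∖ Y
    ∈∖⁺ p q = from T-∧ (p , T-not⁺ q)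
      where
        T-not⁺ : ∀ {x} → ¬ T x → T (not x)
        T-not⁺ {true} ¬t = ¬t tt
        T-not⁺ {false} _ = tt

    ∈∖⁻ : a ∈ X ∖ Y → a ∈ X × a ∉ Y
    ∈∖⁻ = map₂ T-not⁻ ∘ to T-∧
      where
        T-not⁻ : ∀ {x} → T (not x) → ¬ T x
        T-not⁻ {true} ()

    ∈⇒T : a ∈ X → T (X a)
    ∈⇒T p = p

    T⇒∈ : (X : Subset n) → T (X a) → a ∈ X
    T⇒∈ X p = p

    ∉⇒false : a ∉ X → X a ≡ false
    ∉⇒false {a = a} {X = X} a∉X with X a
    ... | true = ⊥-elim (a∉X tt)
    ... | false = refl

    ∩-apply : (X Y : Subset n) (a : Fin n) → (X ∩ Y) a ≡ X a ∧ Y a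
    ∩-apply X Y a = refl

    ∣∣-split : (X Y : Subset n) → ∣ X ∣ ≡ ∣ X ∩ Y ∣ + ∣ X ∖ Y ∣
    ∣∣-split {zero} X Y = refl
    ∣∣-split {suc n} X Y with X zero | Y zero | ∣∣-split (X ∘ suc) (Y ∘ suc)
    ... | true | true | ih = cong suc ih
    ... | true | false | ih = trans (cong suc ih) (sym (+-suc _ _))
    ... | false | _ | ih = ih

    ∣∣-mono : X ⊆ Y → ∣ X ∣ ≤ ∣ Y ∣
    ∣∣-mono {zero} X⊆Y = z≤n
    ∣∣-mono {suc n} {X} {Y} X⊆Y with X zero | Y zero | X⊆Y {zero} | ∣∣-mono {X = X ∘ suc} {Y ∘ suc} X⊆Y
    ... | true | true | _ | ih = s≤s ih
    ... | true | false | 0∈Y | _ = ⊥-elim (0∈Y tt)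
    ... | false | true | _ | ih = m≤n⇒m≤1+n ih
    ... | false | false | _ | ih = ih

    ∣∪∣≤ : (X Y : Subset n) → ∣ X ∪ Y ∣ ≤ ∣ X ∣ + ∣ Y ∣
    ∣∪∣≤ {zero} X Y = z≤n
    ∣∪∣≤ {suc n} X Y with X zero | Y zero | ∣∪∣≤ (X ∘ suc) (Y ∘ suc)
    ... | true | true | ih = s≤s (≤-trans ih (+-monoʳ-≤ _ (n≤1+n _)))
    ... | true | false | ih = s≤s ih
    ... | false | true | ih = ≤-trans (s≤s ih) (≤-reflexive (sym (+-suc _ _)))
    ... | false | false | ih = ih

    ∣∪∣-disjoint : Disjoint X Y → ∣ X ∪ Y ∣ ≡ ∣ X ∣ + ∣ Y ∣
    ∣∪∣-disjoint {zero} X#Y = refl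
    ∣∪∣-disjoint {suc n} {X} {Y} X#Y with X zero | Y zero | X#Y {zero} | ∣∪∣-disjoint {X = X ∘ suc} {Y ∘ suc} X#Y
    ... | true | true | 0∉X∩Y | _ = ⊥-elim (0∉X∩Y tt tt)
    ... | true | false | _ | ih = cong suc ih
    ... | false | true | _ | ih = trans (cong suc ih) (sym (+-suc _ _))
    ... | false | false | _ | ih = ih

    nonempty : 0 < ∣ X ∣ → ∃ (_∈ X)
    nonempty {suc n} {X} pos with X zero in eq
    ... | true = zero , subst T (sym eq) tt
    ... | false with nonempty {X = X ∘ suc} pos
    ...   | a , a∈X = suc a , a∈X

    ∣∅∣ : ∀ n → ∣ ∅ {n} ∣ ≡ 0
    ∣∅∣ zero = refl
    ∣∅∣ (suc n) = ∣∅∣ n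

    ∣full∣ : ∀ n → ∣ full {n} ∣ ≡ n
    ∣full∣ zero = refl
    ∣full∣ (suc n) = cong suc (∣full∣ n)

    card≡∣∣ : (X : Subset n) → card X ≡ ∣ X ∣
    card≡∣∣ X = filter-tabulate X (λ a → a)
      where
        filter-tabulate : ∀ {m k} (X : Subset m) (f : Fin k → Fin m) →
          length (filter (λ a → X a ≟ true) (tabulate f)) ≡ ∣ X ∘ f ∣
        filter-tabulate {k = zero} X f = refl
        filter-tabulate {k = suc k} X f with X (f zero)
        ... | true = cong suc (filter-tabulate X (f ∘ suc))
        ... | false = filter-tabulate X (f ∘ suc)

  ∩⊆ˡ : X ∩ Y ⊆ X
  ∩⊆ˡ = proj₁ ∘ ∈∩⁻

  ∩⊆ʳ : X ∩ Y ⊆ Y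
  ∩⊆ʳ = proj₂ ∘ ∈∩⁻

  ∖⊆ˡ : X ∖ Y ⊆ X
  ∖⊆ˡ = proj₁ ∘ ∈∖⁻

  ∩-monoˡ : X ⊆ Y → X ∩ Z ⊆ Y ∩ Z
  ∩-monoˡ X⊆Y p with ∈∩⁻ p
  ... | p₁ , p₂ = ∈∩⁺ (X⊆Y p₁) p₂

  ∖-monoˡ : X ⊆ Y → X ∖ Z ⊆ Y ∖ Z
  ∖-monoˡ X⊆Y p with ∈∖⁻ p
  ... | p₁ , p₂ = ∈∖⁺ (X⊆Y p₁) p₂

  ∣∣-cong : X ⊆ Y → Y ⊆ X → ∣ X ∣ ≡ ∣ Y ∣
  ∣∣-cong X⊆Y Y⊆X = ≤-antisym (∣∣-mono X⊆Y) (∣∣-mono Y⊆X)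

  ∣∣-≗ : (∀ a → X a ≡ Y a) → ∣ X ∣ ≡ ∣ Y ∣
  ∣∣-≗ {X = X} {Y = Y} X≗Y =
    ∣∣-cong (λ {a} p → T⇒∈ Y (subst T (X≗Y a) (∈⇒T p))) (λ {a} p → T⇒∈ X (subst T (sym (X≗Y a)) (∈⇒T p)))

  ∣∣-⊆-split : Y ⊆ X → ∣ X ∣ ≡ ∣ Y ∣ + ∣ X ∖ Y ∣
  ∣∣-⊆-split {Y = Y} {X = X} Y⊆X = begin
    ∣ X ∣                 ≡⟨ ∣∣-split X Y ⟩
    ∣ X ∩ Y ∣ + ∣ X ∖ Y ∣ ≡⟨ cong (_+ ∣ X ∖ Y ∣) (∣∣-cong ∩⊆ʳ (λ p → ∈∩⁺ (Y⊆X p) p)) ⟩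
    ∣ Y ∣ + ∣ X ∖ Y ∣     ∎
    where open ≡-Reasoning

  ⊆-refl : X ⊆ X
  ⊆-refl p = p

  ⊆-trans : X ⊆ Y → Y ⊆ Z → X ⊆ Z
  ⊆-trans X⊆Y Y⊆Z = Y⊆Z ∘ X⊆Y

  Disjoint-sym : Disjoint X Y → Disjoint Y X
  Disjoint-sym X#Y a∈Y a∈X = X#Y a∈X a∈Y

  Disjoint-mono : ∀ {X′ Y′ : Subset n} → X′ ⊆ X → Y′ ⊆ Y → Disjoint X Y → Disjoint X′ Y′
  Disjoint-mono X′⊆X Y′⊆Y X#Y a∈X′ a∈Y′ = X#Y (X′⊆X a∈X′) (Y′⊆Y a∈Y′)

  Disjoint-∖ : Disjoint Y (X ∖ Y)
  Disjoint-∖ a∈Y a∈X∖Y = proj₂ (∈∖⁻ a∈X∖Y) a∈Y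

  private variable
    Xs : List (Subset n)
    c m : ℕ

  ∈⋃⁺ : Any (a ∈_) Xs → a ∈ ⋃ Xs
  ∈⋃⁺ (here p) = ∈∪⁺ (inj₁ p)
  ∈⋃⁺ (there p) = ∈∪⁺ (inj₂ (∈⋃⁺ p))

  ∈⋃⁻ : a ∈ ⋃ Xs → Any (a ∈_) Xs
  ∈⋃⁻ {Xs = []} p = ⊥-elim (∉∅ p)
  ∈⋃⁻ {Xs = X ∷ Xs} p with ∈∪⁻ p
  ... | inj₁ q = here q
  ... | inj₂ q = there (∈⋃⁻ q)

  ⋃-least : All (_⊆ Y) Xs → ⋃ Xs ⊆ Y
  ⋃-least Xs⊆Y a∈⋃ = lookupWith (λ X⊆Y a∈X → X⊆Y a∈X) Xs⊆Y (∈⋃⁻ a∈⋃)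

  disjoint-⋃ : All (Disjoint X) Xs → Disjoint X (⋃ Xs)
  disjoint-⋃ X#Xs a∈X a∈⋃ = lookupWith (λ X#Y a∈Y → X#Y a∈X a∈Y) X#Xs (∈⋃⁻ a∈⋃)

  length*≤∣⋃∣ : ∀ c → AllPairs Disjoint Xs → All (λ X → m ≤ c * ∣ X ∣) Xs → length Xs * m ≤ c * ∣ ⋃ Xs ∣
  length*≤∣⋃∣ c [] [] = z≤n
  length*≤∣⋃∣ {Xs = X ∷ Xs} {m} c (X#Xs ∷ disjoint) (large ∷ larges) = begin
    m + length Xs * m         ≤⟨ +-mono-≤ large (length*≤∣⋃∣ c disjoint larges) ⟩
    c * ∣ X ∣ + c * ∣ ⋃ Xs ∣  ≡⟨ *-distribˡ-+ c ∣ X ∣ ∣ ⋃ Xs ∣ ⟨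
    c * (∣ X ∣ + ∣ ⋃ Xs ∣)    ≡⟨ cong (c *_) (∣∪∣-disjoint (disjoint-⋃ X#Xs)) ⟨
    c * ∣ X ∪ ⋃ Xs ∣          ∎
    where open ≤-Reasoning

  ∣⋃∣≤length* : ∀ {n} {Xs : List (Subset n)} c → All (λ X → c * ∣ X ∣ ≤ m) Xs → c * ∣ ⋃ Xs ∣ ≤ length Xs * m
  ∣⋃∣≤length* {n = n} c [] = ≤-reflexive (trans (cong (c *_) (∣∅∣ n)) (*-zeroʳ c))
  ∣⋃∣≤length* {m = m} {Xs = X ∷ Xs} c (small ∷ smalls) = begin
    c * ∣ X ∪ ⋃ Xs ∣          ≤⟨ *-monoʳ-≤ c (∣∪∣≤ X (⋃ Xs)) ⟩
    c * (∣ X ∣ + ∣ ⋃ Xs ∣)    ≡⟨ *-distribˡ-+ c ∣ X ∣ ∣ ⋃ Xs ∣ ⟩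
    c * ∣ X ∣ + c * ∣ ⋃ Xs ∣  ≤⟨ +-mono-≤ small (∣⋃∣≤length* c smalls) ⟩
    m + length Xs * m         ∎
    where open ≤-Reasoning

module SplitTrees where

  open import Defs using (Graph; Subset; Symmetric; Stable)
  open import Data.Bool using (true; false)
  open import Data.Bool.Properties using (T-≡)
  open import Data.Empty using (⊥; ⊥-elim)
  open import Data.Fin using (Fin; zero; suc; toℕ; inject₁) renaming (_≤_ to _≤ᶠ_; _<_ to _<ᶠ_)
  open import Data.Fin.Properties using (any?; toℕ-inject₁; ≤̄⇒inject₁<)
  open import Data.Nat using (ℕ; zero; suc; _+_; z≤n; s≤s)
  import Data.Nat as ℕ
  open import Data.Nat.Properties using (+-suc)
  open import Data.Vec.Functional using (_∷_)
  import Data.Sum as Sum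
  open import Data.Product using (∃; _×_; _,_; proj₁; proj₂)
  open import Data.Sum using (_⊎_; inj₁; inj₂)
  open import Data.Unit using (⊤; tt)
  open import Relation.Nullary using (¬_; Dec; yes)
  open import Relation.Nullary.Decidable using (_×-dec_)
  open import Relation.Binary.PropositionalEquality using (_≡_; refl; subst; trans)
  open import Function using (_∘_; Equivalence)
  open FiniteSets

  ladderDepth : ℕ → ℕ → ℕ
  ladderDepth zero y = 0
  ladderDepth (suc x) zero = 0
  ladderDepth (suc x) (suc y) = suc (ladderDepth x (suc y)) + suc (ladderDepth (suc x) y)

  _>ᶠ_ : ∀ {k} → Fin k → Fin k → Set
  i >ᶠ j = j <ᶠ i

  module _ {n : ℕ} (E : Graph n) where

    nbhd : Fin n → Subset n
    nbhd b a = E a b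

    private variable
      a b v : Fin n
      A B : Subset n
      Π : Fin n → Set
      k : ℕ

    ∈nbhd⁺ : E a b ≡ true → a ∈ nbhd b
    ∈nbhd⁺ {b = b} = T⇒∈ (nbhd b) ∘ Equivalence.from T-≡

    ∈nbhd⁻ : a ∈ nbhd b → E a b ≡ true
    ∈nbhd⁻ = Equivalence.to T-≡ ∘ ∈⇒T

    SplitTree : (Fin n → Set) → ℕ → Subset n → Set
    SplitTree Π zero A = ∃ (_∈ A)
    SplitTree Π (suc d) A = ∃ λ b → Π b × SplitTree Π d (A ∩ nbhd b) × SplitTree Π d (A ∖ nbhd b)

    Shatters : ℕ → Subset n → Set
    Shatters = SplitTree (λ _ → ⊤)

    shatters? : ∀ d A → Dec (Shatters d A)
    shatters? zero A = any? (_∈? A)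
    shatters? (suc d) A = any? λ b → yes tt ×-dec shatters? d (A ∩ nbhd b) ×-dec shatters? d (A ∖ nbhd b)

    SplitTree-nonempty : ∀ d → SplitTree Π d A → ∃ (_∈ A)
    SplitTree-nonempty zero t = t
    SplitTree-nonempty (suc d) (_ , _ , t , _) with SplitTree-nonempty d t
    ... | a , a∈A∩N = a , proj₁ (∈∩⁻ a∈A∩N)

    SplitTree-mono : ∀ d → A ⊆ B → SplitTree Π d A → SplitTree Π d B
    SplitTree-mono zero A⊆B (a , a∈A) = a , A⊆B a∈A
    SplitTree-mono (suc d) A⊆B (b , πb , t₁ , t₀) =
      b , πb , SplitTree-mono d (∩-monoˡ A⊆B) t₁ , SplitTree-mono d (∖-monoˡ A⊆B) t₀

    SplitTree-ramsey : ∀ p q v → SplitTree Π (p + q) A →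
      SplitTree (λ b → Π b × E v b ≡ true) p A ⊎ SplitTree (λ b → Π b × E v b ≡ false) q A
    SplitTree-ramsey zero q v t = inj₁ (SplitTree-nonempty q t)
    SplitTree-ramsey (suc p) zero v t = inj₂ (SplitTree-nonempty (suc p + 0) t)
    SplitTree-ramsey (suc p) (suc q) v (b , πb , t₁ , t₀) with E v b in vb
    ... | true with SplitTree-ramsey p (suc q) v t₁ | SplitTree-ramsey p (suc q) v t₀
    ...   | inj₁ t₁′ | inj₁ t₀′ = inj₁ (b , (πb , vb) , t₁′ , t₀′)
    ...   | inj₂ t₁′ | _ = inj₂ (SplitTree-mono (suc q) ∩⊆ˡ t₁′)
    ...   | inj₁ _ | inj₂ t₀′ = inj₂ (SplitTree-mono (suc q) ∖⊆ˡ t₀′)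
    SplitTree-ramsey {Π = Π} {A = A} (suc p) (suc q) v (b , πb , t₁ , t₀) | false
      with SplitTree-ramsey (suc p) q v (subst (λ d → SplitTree Π d (A ∩ nbhd b)) (+-suc p q) t₁)
         | SplitTree-ramsey (suc p) q v (subst (λ d → SplitTree Π d (A ∖ nbhd b)) (+-suc p q) t₀)
    ...   | inj₂ t₁′ | inj₂ t₀′ = inj₂ (b , (πb , vb) , t₁′ , t₀′)
    ...   | inj₁ t₁′ | _ = inj₁ (SplitTree-mono (suc p) ∩⊆ˡ t₁′)
    ...   | inj₂ _ | inj₁ t₀′ = inj₁ (SplitTree-mono (suc p) ∖⊆ˡ t₀′)

    HalfGraph : ∀ {k} → (Fin k → Fin k → Set) → (Fin k → Fin n) → (Fin k → Fin n) → Set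
    HalfGraph R v w = ∀ i j → (E (v i) (w j) ≡ true → R i j) × (R i j → E (v i) (w j) ≡ true)

    record Ladder (R : ∀ {k} → Fin k → Fin k → Set) (Π : Fin n → Set) (A : Subset n) (k : ℕ) : Set where
      field
        left right : Fin k → Fin n
        half-graph : HalfGraph R left right
        left∈A : ∀ i → left i ∈ A
        right∈Π : ∀ j → Π (right j)

    open Ladder

    private variable
      R : ∀ {k} → Fin k → Fin k → Set
      Π′ : Fin n → Set

    empty-ladder : Ladder R Π A 0
    empty-ladder = record { left = λ () ; right = λ () ; half-graph = λ () ; left∈A = λ () ; right∈Π = λ () }

    Ladder-weaken : A ⊆ B → (∀ {b} → Π b → Π′ b) → Ladder R Π A k → Ladder R Π′ B k
    Ladder-weaken A⊆B Π⇒Π′ L = record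
      { left = left L ; right = right L ; half-graph = half-graph L
      ; left∈A = A⊆B ∘ left∈A L ; right∈Π = Π⇒Π′ ∘ right∈Π L }

    private
      true≢false : ∀ {x} → x ≡ true → x ≡ false → ⊥
      true≢false refl ()

    ladder-cons : v ∈ A → Π b → E v b ≡ true →
      Ladder _≤ᶠ_ (λ w → Π w × E v w ≡ true) (A ∖ nbhd b) k → Ladder _≤ᶠ_ Π A (suc k)
    ladder-cons {v = v} {b = b} v∈A πb vb L = record
      { left = v ∷ left L ; right = b ∷ right L ; half-graph = half-graph′
      ; left∈A = λ { zero → v∈A ; (suc i) → ∖⊆ˡ (left∈A L i) }
      ; right∈Π = λ { zero → πb ; (suc j) → proj₁ (right∈Π L j) } }
      where
        half-graph′ : HalfGraph _≤ᶠ_ (v ∷ left L) (b ∷ right L)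
        half-graph′ zero zero = (λ _ → z≤n) , (λ _ → vb)
        half-graph′ zero (suc j) = (λ _ → z≤n) , (λ _ → proj₂ (right∈Π L j))
        half-graph′ (suc i) zero = (λ e → ⊥-elim (proj₂ (∈∖⁻ (left∈A L i)) (∈nbhd⁺ e))) , (λ ())
        half-graph′ (suc i) (suc j) =
          (λ e → s≤s (proj₁ (half-graph L i j) e)) , (λ { (s≤s i≤j) → proj₂ (half-graph L i j) i≤j })

    coladder-cons : v ∈ A → Π b → E v b ≡ false →
      Ladder _>ᶠ_ (λ w → Π w × E v w ≡ false) (A ∩ nbhd b) k → Ladder _>ᶠ_ Π A (suc k)
    coladder-cons {v = v} {b = b} v∈A πb vb L = record
      { left = v ∷ left L ; right = b ∷ right L ; half-graph = half-graph′
      ; left∈A = λ { zero → v∈A ; (suc i) → ∩⊆ˡ (left∈A L i) }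
      ; right∈Π = λ { zero → πb ; (suc j) → proj₁ (right∈Π L j) } }
      where
        half-graph′ : HalfGraph _>ᶠ_ (v ∷ left L) (b ∷ right L)
        half-graph′ zero zero = (λ e → ⊥-elim (true≢false e vb)) , (λ ())
        half-graph′ zero (suc j) = (λ e → ⊥-elim (true≢false e (proj₂ (right∈Π L j)))) , (λ ())
        half-graph′ (suc i) zero = (λ _ → s≤s z≤n) , (λ _ → ∈nbhd⁻ (∩⊆ʳ (left∈A L i)))
        half-graph′ (suc i) (suc j) =
          (λ e → s≤s (proj₁ (half-graph L i j) e)) , (λ { (s≤s j<i) → proj₂ (half-graph L i j) j<i })

    ladder-or-coladder : ∀ x y → SplitTree Π (ladderDepth x y) A → Ladder _≤ᶠ_ Π A x ⊎ Ladder _>ᶠ_ Π A y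
    ladder-or-coladder zero y t = inj₁ empty-ladder
    ladder-or-coladder (suc x) zero t = inj₂ empty-ladder
    ladder-or-coladder (suc x) (suc y) t with SplitTree-nonempty (ladderDepth (suc x) (suc y)) t
    ... | v , v∈A with SplitTree-ramsey (suc (ladderDepth x (suc y))) (suc (ladderDepth (suc x) y)) v t
    ...   | inj₁ (b , (πb , vb) , _ , t₀) =
      Sum.map (ladder-cons v∈A πb vb) (Ladder-weaken ∖⊆ˡ proj₁) (ladder-or-coladder x (suc y) t₀)
    ...   | inj₂ (b , (πb , vb) , t₁ , _) =
      Sum.map (Ladder-weaken ∩⊆ˡ proj₁) (coladder-cons v∈A πb vb) (ladder-or-coladder (suc x) y t₁)

    stable⇒¬Shatters : Symmetric E → ∀ k → Stable k E → ¬ Shatters (ladderDepth k (suc k)) full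
    stable⇒¬Shatters symmetric k stable t with ladder-or-coladder k (suc k) t
    ... | inj₁ L = stable (left L , right L , half-graph L)
    ... | inj₂ L = stable (right L ∘ inject₁ , left L ∘ suc , half-graph′)
      where
        half-graph′ : HalfGraph _≤ᶠ_ (right L ∘ inject₁) (left L ∘ suc)
        half-graph′ i j =
          (λ e → inject₁<suc⇒≤ (proj₁ (half-graph L (suc j) (inject₁ i)) (trans (symmetric _ _) e))) ,
          (λ i≤j → trans (symmetric _ _) (proj₂ (half-graph L (suc j) (inject₁ i)) (≤̄⇒inject₁< i≤j)))
          where
            inject₁<suc⇒≤ : inject₁ i <ᶠ suc j → i ≤ᶠ j
            inject₁<suc⇒≤ (s≤s p) = subst (ℕ._≤ toℕ j) (toℕ-inject₁ i) p

module Decompositions where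

  open import Defs using (Graph; Subset)
  open import Data.Fin.Properties using (any?)
  open import Data.List using (List; []; _∷_; length; map; filter; _++_)
  open import Data.List.Properties using (length-++; length-map; length-filter)
  open import Data.List.Relation.Unary.All as All using (All; []; _∷_)
  import Data.List.Relation.Unary.All.Properties as Allₚ
  open import Data.List.Relation.Unary.AllPairs as AllPairs using (AllPairs; []; _∷_)
  import Data.List.Relation.Unary.AllPairs.Properties as AllPairsₚ
  open import Data.List.Relation.Unary.Any as Any using (Any; here; there)
  import Data.List.Relation.Unary.Any.Properties as Anyₚ
  open import Data.Nat using (ℕ; zero; suc; _+_; _*_; _≤_; _<_; _≤?_; _<?_; z≤n; >-nonZero)
  open import Data.Nat.Tactic.RingSolver using (solve-∀)
  open import Data.Nat.Induction using (<-wellFounded)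
  open import Data.Nat.Properties
  open import Data.Product using (∃; Σ; _×_; _,_; proj₁; proj₂)
  open import Data.Sum using (_⊎_; inj₁; inj₂; [_,_]′)
  open import Data.Unit using (tt)
  open import Data.Empty using (⊥-elim)
  open import Function using (_∘_)
  open import Induction.WellFounded using (Acc; acc)
  open import Relation.Nullary using (¬_; Dec; yes; no; ¬?)
  open import Relation.Nullary.Decidable using (_×-dec_; _⊎-dec_; decidable-stable)
  open import Relation.Binary using (_Preserves_⟶_)
  open import Relation.Binary.PropositionalEquality using (_≡_; refl; cong; sym; trans; subst)
  open FiniteSets
  open SplitTrees
  open RunningMaximum
  open ListProperties

  module _ {n : ℕ} (E : Graph n) where

    Goodℕ : ℕ → Subset n → Set
    Goodℕ Q X = 0 < ∣ X ∣ × ∀ b → Q * ∣ X ∩ nbhd E b ∣ < ∣ X ∣ ⊎ Q * ∣ X ∖ nbhd E b ∣ < ∣ X ∣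

    Goodℕ-anti : ∀ {Q Q′ X} → Q ≤ Q′ → Goodℕ Q′ X → Goodℕ Q X
    Goodℕ-anti {Q} {Q′} {X} Q≤Q′ (nonempty , balanced) = nonempty , λ b → lower (balanced b)
      where
        lower : ∀ {x y} → Q′ * x < ∣ X ∣ ⊎ Q′ * y < ∣ X ∣ → Q * x < ∣ X ∣ ⊎ Q * y < ∣ X ∣
        lower (inj₁ p) = inj₁ (≤-<-trans (*-monoˡ-≤ _ Q≤Q′) p)
        lower (inj₂ p) = inj₂ (≤-<-trans (*-monoˡ-≤ _ Q≤Q′) p)

    record Decomposition (Fs : List (Subset n)) (N e : ℕ) (T : ℕ → ℕ) : Set where
      field
        parts : List (Subset n)
        few : length parts ≤ N
        disjoint : AllPairs Disjoint parts
        inside : All (_⊆ ⋃ Fs) parts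
        good : All (Goodℕ (T (length parts))) parts
        small-remainder : e * ∣ ⋃ Fs ∖ ⋃ parts ∣ ≤ ∣ ⋃ Fs ∣

    trivial-decomposition : ∀ {Fs N e T} → ∣ ⋃ Fs ∣ ≡ 0 → Decomposition Fs N e T
    trivial-decomposition {Fs} {e = e} empty = record
      { parts = [] ; few = z≤n ; disjoint = [] ; inside = [] ; good = []
      ; small-remainder = ≤-trans (≤-reflexive (trans (cong (e *_) remainder-empty) (*-zeroʳ e))) z≤n }
      where
        remainder-empty : ∣ ⋃ Fs ∖ ⋃ [] ∣ ≡ 0
        remainder-empty = n≤0⇒n≡0 (≤-trans (∣∣-mono ∖⊆ˡ) (≤-reflexive empty))

  DecompositionBound : ℕ → Set
  DecompositionBound r = (P e : ℕ) (T : ℕ → ℕ) → T Preserves _≤_ ⟶ _≤_ →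
    ∃ λ N → ∀ {n} (E : Graph n) (Fs : List (Subset n)) → length Fs ≤ P → AllPairs Disjoint Fs →
      All (¬_ ∘ Shatters E r) Fs → Decomposition E Fs N e T

  module Carving {n : ℕ} (E : Graph n) (r : ℕ) (Fs : List (Subset n)) (u>0 : 0 < ∣ ⋃ Fs ∣) where

    U : Subset n
    U = ⋃ Fs

    u : ℕ
    u = ∣ U ∣

    Carvable : ℕ → Subset n → Set
    Carvable c Y = u ≤ c * ∣ Y ∣ × ¬ Shatters E r Y

    carvable? : ∀ c Y → Dec (Carvable c Y)
    carvable? c Y = u ≤? c * ∣ Y ∣ ×-dec ¬? (shatters? E r Y)

    CarvableIn : ℕ → Subset n → Subset n → Set
    CarvableIn c R S = ∃ λ b → Carvable c (R ∩ S ∩ nbhd E b) ⊎ Carvable c (R ∩ S ∖ nbhd E b)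

    Solid : ℕ → Subset n → Set
    Solid c R = All (¬_ ∘ CarvableIn c R) Fs

    carvable-or-solid : ∀ c R → (∃ λ Y → Y ⊆ R × Carvable c Y) ⊎ Solid c R
    carvable-or-solid c R
      with Any.any? (λ S → any? λ b → carvable? c (R ∩ S ∩ nbhd E b) ⊎-dec carvable? c (R ∩ S ∖ nbhd E b)) Fs
    ... | no none = inj₂ (Allₚ.¬Any⇒All¬ Fs none)
    ... | yes found with Any.satisfied found
    ...   | _ , _ , inj₁ carvable = inj₁ (_ , ⊆-trans ∩⊆ˡ ∩⊆ˡ , carvable)
    ...   | _ , _ , inj₂ carvable = inj₁ (_ , ⊆-trans ∖⊆ˡ ∩⊆ˡ , carvable)

    large-nonempty : ∀ c {Y : Subset n} → u ≤ c * ∣ Y ∣ → 0 < ∣ Y ∣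
    large-nonempty c large = n≢0⇒n>0 λ empty → <⇒≱ u>0 (subst (u ≤_) (trans (cong (c *_) empty) (*-zeroʳ c)) large)

    record State (c : ℕ) : Set where
      field
        pieces : List (Subset n)
        rest : Subset n
        rest⊆U : rest ⊆ U
        covers : ∀ {a} → a ∈ U → Any (a ∈_) pieces ⊎ a ∈ rest
        pieces-disjoint : AllPairs Disjoint pieces
        pieces⊆U : All (_⊆ U) pieces
        pieces#rest : All (λ X → Disjoint X rest) pieces
        pieces-carvable : All (Carvable c) pieces

    open State

    initial : ∀ {c} → State c
    initial = record
      { pieces = [] ; rest = U ; rest⊆U = ⊆-refl ; covers = inj₂ ; pieces-disjoint = []
      ; pieces⊆U = [] ; pieces#rest = [] ; pieces-carvable = [] }

    State-weaken : ∀ {c c′} → c ≤ c′ → State c → State c′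
    State-weaken c≤c′ st = record
      { pieces = pieces st ; rest = rest st ; rest⊆U = rest⊆U st ; covers = covers st
      ; pieces-disjoint = pieces-disjoint st ; pieces⊆U = pieces⊆U st ; pieces#rest = pieces#rest st
      ; pieces-carvable = All.map (λ (large , low) → ≤-trans large (*-monoˡ-≤ _ c≤c′) , low) (pieces-carvable st) }

    carve-step : ∀ {c} {Y : Subset n} (st : State c) → Y ⊆ rest st → Carvable c Y → State c
    carve-step {Y = Y} st Y⊆R carvable = record
      { pieces = Y ∷ pieces st
      ; rest = rest st ∖ Y
      ; rest⊆U = ⊆-trans ∖⊆ˡ (rest⊆U st)
      ; covers = covers′
      ; pieces-disjoint = All.map (Disjoint-sym ∘ Disjoint-mono ⊆-refl Y⊆R) (pieces#rest st) ∷ pieces-disjoint st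
      ; pieces⊆U = ⊆-trans Y⊆R (rest⊆U st) ∷ pieces⊆U st
      ; pieces#rest = Disjoint-∖ ∷ All.map (Disjoint-mono ⊆-refl ∖⊆ˡ) (pieces#rest st)
      ; pieces-carvable = carvable ∷ pieces-carvable st
      }
      where
        covers′ : ∀ {a} → a ∈ U → Any (a ∈_) (Y ∷ pieces st) ⊎ a ∈ rest st ∖ Y
        covers′ {a} a∈U with covers st a∈U | a ∈? Y
        ... | inj₁ a∈pieces | _ = inj₁ (there a∈pieces)
        ... | inj₂ _ | yes a∈Y = inj₁ (here a∈Y)
        ... | inj₂ a∈R | no a∉Y = inj₂ (∈∖⁺ a∈R a∉Y)

    carve-step-shrinks : ∀ {c} {Y : Subset n} (st : State c) (Y⊆R : Y ⊆ rest st) (carvable : Carvable c Y) →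
      ∣ rest (carve-step st Y⊆R carvable) ∣ < ∣ rest st ∣
    carve-step-shrinks {c} {Y} st Y⊆R carvable =
      subst (∣ rest st ∖ Y ∣ <_) (sym (∣∣-⊆-split Y⊆R)) (+-monoˡ-≤ _ (large-nonempty c (proj₁ carvable)))

    carve : ∀ {c} (st : State c) → Acc _<_ ∣ rest st ∣ → Σ (State c) λ st′ → rest st′ ⊆ rest st × Solid c (rest st′)
    carve {c} st (acc smaller) with carvable-or-solid c (rest st)
    ... | inj₂ solid = st , ⊆-refl , solid
    ... | inj₁ (Y , Y⊆R , carvable) with carve (carve-step st Y⊆R carvable) (smaller (carve-step-shrinks st Y⊆R carvable))
    ...   | st′ , R′⊆R∖Y , solid = st′ , ⊆-trans R′⊆R∖Y ∖⊆ˡ , solid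

    solid⇒good : ∀ {c M Q} {R S : Subset n} → ¬ Shatters E (suc r) S → ¬ CarvableIn c R S → M * Q ≤ c →
      u ≤ M * ∣ R ∩ S ∣ → Goodℕ E Q (R ∩ S)
    solid⇒good {c} {M} {Q} {R} {S} low-rank solid MQ≤c large = large-nonempty M large , balanced
      where
        X : Subset n
        X = R ∩ S

        large-side-shatters : ∀ {Y : Subset n} → ¬ Carvable c Y → ∣ X ∣ ≤ Q * ∣ Y ∣ → Shatters E r Y
        large-side-shatters {Y} not-carvable X≤QY = decidable-stable (shatters? E r Y) λ low → not-carvable (large-side , low)
          where
            large-side : u ≤ c * ∣ Y ∣
            large-side = begin
              u                 ≤⟨ large ⟩
              M * ∣ X ∣         ≤⟨ *-monoʳ-≤ M X≤QY ⟩
              M * (Q * ∣ Y ∣)   ≡⟨ *-assoc M Q ∣ Y ∣ ⟨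
              M * Q * ∣ Y ∣     ≤⟨ *-monoˡ-≤ ∣ Y ∣ MQ≤c ⟩
              c * ∣ Y ∣         ∎
              where open ≤-Reasoning

        balanced : ∀ b → Q * ∣ X ∩ nbhd E b ∣ < ∣ X ∣ ⊎ Q * ∣ X ∖ nbhd E b ∣ < ∣ X ∣
        balanced b with Q * ∣ X ∩ nbhd E b ∣ <? ∣ X ∣ | Q * ∣ X ∖ nbhd E b ∣ <? ∣ X ∣
        ... | yes small | _ = inj₁ small
        ... | no _ | yes small = inj₂ small
        ... | no big₁ | no big₀ = ⊥-elim (low-rank (SplitTree-mono E (suc r) ∩⊆ʳ
              (b , tt , large-side-shatters (solid ∘ (b ,_) ∘ inj₁) (≮⇒≥ big₁)
                      , large-side-shatters (solid ∘ (b ,_) ∘ inj₂) (≮⇒≥ big₀))))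

    module Stages (K : ℕ) (threshold : ℕ → ℕ) (threshold-mono : ∀ s → threshold s ≤ threshold (suc s)) where

      record Stopped : Set where
        field
          stage : ℕ
          stage≤K : stage ≤ K
          state : State (threshold stage)
          core : Subset n
          core⊆rest : core ⊆ rest state
          removed-small : K * ∣ rest state ∖ core ∣ ≤ u
          core-solid : Solid (threshold (suc stage)) core

      MassBound : ℕ → Subset n → Set
      MassBound s R = s * u + K * ∣ R ∣ ≤ K * u

      MassBound⇒≤K : ∀ {s} {R : Subset n} → MassBound s R → s ≤ K
      MassBound⇒≤K {s} {R} bound = *-cancelʳ-≤ s K u {{>-nonZero u>0}} (≤-trans (m≤m+n (s * u) (K * ∣ R ∣)) bound)

      MassBound-step : ∀ {s} {R R′ : Subset n} → R′ ⊆ R → MassBound s R → u < K * ∣ R ∖ R′ ∣ → MassBound (suc s) R′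
      MassBound-step {s} {R} {R′} R′⊆R bound removed-large = begin
        u + s * u + K * ∣ R′ ∣                 ≤⟨ +-monoˡ-≤ (K * ∣ R′ ∣) (+-monoˡ-≤ (s * u) (<⇒≤ removed-large)) ⟩
        K * ∣ R ∖ R′ ∣ + s * u + K * ∣ R′ ∣    ≡⟨ rearrange K (∣ R ∖ R′ ∣) (s * u) (∣ R′ ∣) ⟩
        s * u + K * (∣ R′ ∣ + ∣ R ∖ R′ ∣)      ≡⟨ cong (λ m → s * u + K * m) (∣∣-⊆-split R′⊆R) ⟨
        s * u + K * ∣ R ∣                      ≤⟨ bound ⟩
        K * u                                  ∎
        where
          open ≤-Reasoning
          rearrange : ∀ K y t x → K * y + t + K * x ≡ t + K * (x + y)
          rearrange = solve-∀

      stages : ∀ f s → K < s + f → (st : State (threshold s)) → MassBound s (rest st) → Stopped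
      stages zero s K<s+0 _ bound = ⊥-elim (<⇒≱ (subst (K <_) (+-identityʳ s) K<s+0) (MassBound⇒≤K bound))
      stages (suc f) s K<s+f st bound with carve (State-weaken (threshold-mono s) st) (<-wellFounded _)
      ... | st′ , R′⊆R , solid with K * ∣ rest st ∖ rest st′ ∣ ≤? u
      ...   | yes small = record
        { stage = s ; stage≤K = MassBound⇒≤K bound ; state = st ; core = rest st′ ; core⊆rest = R′⊆R
        ; removed-small = small ; core-solid = solid }
      ...   | no large = stages f (suc s) (subst (K <_) (+-suc s f) K<s+f) st′ (MassBound-step {s} R′⊆R bound (≰⇒> large))

      -- Opaque, as otherwise Agda evaluates the carving symbolically while checking its uses.
      opaque
        stopped : Stopped
        stopped = stages (suc K) 0 ≤-refl initial (≤-reflexive refl)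

  thirds : ∀ e {x y z u} → 3 * e * x ≤ u → 3 * e * y ≤ u → 3 * e * z ≤ u → e * (x + y + z) ≤ u
  thirds e {x} {y} {z} {u} x-small y-small z-small = *-cancelˡ-≤ 3 (begin
    3 * (e * (x + y + z))             ≡⟨ distribute e x y z ⟩
    3 * e * x + 3 * e * y + 3 * e * z ≤⟨ +-mono-≤ (+-mono-≤ x-small y-small) z-small ⟩
    u + u + u                         ≡⟨ triple u ⟩
    3 * u                             ∎)
    where
      open ≤-Reasoning
      distribute : ∀ e x y z → 3 * (e * (x + y + z)) ≡ 3 * e * x + 3 * e * y + 3 * e * z
      distribute = solve-∀
      triple : ∀ u → u + u + u ≡ 3 * u
      triple = solve-∀

  module Step (r : ℕ) (IH : DecompositionBound r) (P e : ℕ) (T : ℕ → ℕ) (T-mono : T Preserves _≤_ ⟶ _≤_) where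

    K M : ℕ
    K = 3 * e
    M = K * suc P

    T′ : ℕ → ℕ
    T′ x = T (x + P)

    T′-mono : T′ Preserves _≤_ ⟶ _≤_
    T′-mono = T-mono ∘ +-monoˡ-≤ P

    bound : ℕ → ℕ
    bound c = proj₁ (IH c K T′ T′-mono)

    -- Pieces carved at threshold c number at most c, so the induction hypothesis yields at most
    -- bound c + P parts in all; the next threshold makes the solid traces good enough for that.
    threshold : ℕ → ℕ
    threshold zero = 1
    threshold (suc s) = threshold s + M * T (bound (threshold s) + P)

    N : ℕ
    N = maxUpTo (bound ∘ threshold) K + P

    module _ {n : ℕ} (E : Graph n) (Fs : List (Subset n)) (Fs-few : length Fs ≤ P) (Fs-disjoint : AllPairs Disjoint Fs)
             (Fs-rank : All (¬_ ∘ Shatters E (suc r)) Fs) (u>0 : 0 < ∣ ⋃ Fs ∣) where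

      open Carving E r Fs u>0
      open Stages K threshold (λ s → m≤m+n (threshold s) _)
      open Stopped stopped
      open State state

      c : ℕ
      c = threshold stage

      pieces-few : length pieces ≤ c
      pieces-few = *-cancelʳ-≤ (length pieces) c u {{>-nonZero u>0}} (begin
        length pieces * u   ≤⟨ length*≤∣⋃∣ c pieces-disjoint (All.map proj₁ pieces-carvable) ⟩
        c * ∣ ⋃ pieces ∣    ≤⟨ *-monoʳ-≤ c (∣∣-mono (⋃-least pieces⊆U)) ⟩
        c * u               ∎)
        where open ≤-Reasoning

      inner : Decomposition E pieces (bound c) K T′
      inner = proj₂ (IH c K T′ T′-mono) E pieces pieces-few pieces-disjoint (All.map proj₂ pieces-carvable)

      module Inner = Decomposition inner

      large? : (X : Subset n) → Dec (u ≤ M * ∣ X ∣)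
      large? X = u ≤? M * ∣ X ∣

      candidates kept thin parts : List (Subset n)
      candidates = map (core ∩_) Fs
      kept = filter large? candidates
      thin = filter (¬? ∘ large?) candidates
      parts = Inner.parts ++ kept

      kept⊆core : All (_⊆ core) kept
      kept⊆core = Allₚ.filter⁺ large? (Allₚ.map⁺ {xs = Fs} {f = core ∩_} (All.tabulate λ _ → ∩⊆ˡ))

      kept-few : length kept ≤ P
      kept-few = begin
        length kept         ≤⟨ length-filter large? candidates ⟩
        length candidates   ≡⟨ length-map (core ∩_) Fs ⟩
        length Fs           ≤⟨ Fs-few ⟩
        P                   ∎
        where open ≤-Reasoning

      parts-length : length parts ≤ length Inner.parts + P
      parts-length = ≤-trans (≤-reflexive (length-++ Inner.parts)) (+-monoʳ-≤ (length Inner.parts) kept-few)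

      parts-few′ : length parts ≤ bound c + P
      parts-few′ = ≤-trans parts-length (+-monoˡ-≤ P Inner.few)

      parts-few : length parts ≤ N
      parts-few = ≤-trans parts-few′ (+-monoˡ-≤ P (≤-maxUpTo (bound ∘ threshold) stage≤K))

      parts-disjoint : AllPairs Disjoint parts
      parts-disjoint = AllPairsₚ.++⁺ Inner.disjoint kept-disjoint
          (All.map inner#kept Inner.inside)
        where
          kept-disjoint : AllPairs Disjoint kept
          kept-disjoint = AllPairsₚ.filter⁺ large? (AllPairsₚ.map⁺ (AllPairs.map (Disjoint-mono ∩⊆ʳ ∩⊆ʳ) Fs-disjoint))
          ⋃pieces#rest : Disjoint (⋃ pieces) rest
          ⋃pieces#rest = Disjoint-sym (disjoint-⋃ (All.map Disjoint-sym pieces#rest))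
          inner#kept : ∀ {Y : Subset n} → Y ⊆ ⋃ pieces → All (Disjoint Y) kept
          inner#kept {Y} Y⊆⋃pieces = All.map {P = _⊆ core} {Q = Disjoint Y}
            (λ X⊆core → Disjoint-mono Y⊆⋃pieces (⊆-trans X⊆core core⊆rest) ⋃pieces#rest) kept⊆core

      parts-inside : All (_⊆ U) parts
      parts-inside = Allₚ.++⁺
        (All.map {P = _⊆ ⋃ pieces} {Q = _⊆ U} (λ Y⊆⋃pieces → ⊆-trans Y⊆⋃pieces (⋃-least pieces⊆U)) Inner.inside)
        (All.map {P = _⊆ core} {Q = _⊆ U} (λ X⊆core → ⊆-trans X⊆core (⊆-trans core⊆rest rest⊆U)) kept⊆core)

      parts-good : All (Goodℕ E (T (length parts))) parts
      parts-good = Allₚ.++⁺ (All.map (Goodℕ-anti E (T-mono parts-length)) Inner.good) kept-good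
        where
          MT≤threshold : M * T (length parts) ≤ threshold (suc stage)
          MT≤threshold = ≤-trans (*-monoʳ-≤ M (T-mono parts-few′)) (m≤n+m _ c)
          candidates-good : All (λ X → u ≤ M * ∣ X ∣ → Goodℕ E (T (length parts)) X) candidates
          candidates-good = Allₚ.map⁺ (All.zipWith (λ (low-rank , solid) → solid⇒good {M = M} low-rank solid MT≤threshold)
                                                   (Fs-rank , core-solid))
          kept-good : All (Goodℕ E (T (length parts))) kept
          kept-good = All.zipWith (λ (good , large) → good large)
                                  (Allₚ.filter⁺ large? candidates-good , Allₚ.all-filter large? candidates)

      core-split : ∀ {a} → a ∈ core → a ∈ U → Any (a ∈_) kept ⊎ Any (a ∈_) thin
      core-split {a} a∈core a∈U =
        Any-filter-⊎ {P = a ∈_} large? {xs = candidates} (Anyₚ.map⁺ {f = core ∩_} (Any.map (∈∩⁺ a∈core) (∈⋃⁻ a∈U)))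

      ∉parts-inner : ∀ {a} → a ∉ ⋃ parts → a ∉ ⋃ Inner.parts
      ∉parts-inner a∉parts a∈inner = a∉parts (∈⋃⁺ (Anyₚ.++⁺ˡ {xs = Inner.parts} {ys = kept} (∈⋃⁻ a∈inner)))

      ∉parts-kept : ∀ {a} → a ∉ ⋃ parts → ¬ Any (a ∈_) kept
      ∉parts-kept a∉parts a∈kept = a∉parts (∈⋃⁺ (Anyₚ.++⁺ʳ Inner.parts a∈kept))

      inner-remainder discarded : Subset n
      inner-remainder = ⋃ pieces ∖ ⋃ Inner.parts
      discarded = rest ∖ core

      remainder⊆ : U ∖ ⋃ parts ⊆ inner-remainder ∪ discarded ∪ ⋃ thin
      remainder⊆ {a} a∈remainder = [ from-pieces , from-rest ]′ (covers a∈U)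
        where
          a∈U : a ∈ U
          a∈U = proj₁ (∈∖⁻ a∈remainder)
          a∉parts : a ∉ ⋃ parts
          a∉parts = proj₂ (∈∖⁻ a∈remainder)
          from-pieces : Any (a ∈_) pieces → a ∈ inner-remainder ∪ discarded ∪ ⋃ thin
          from-pieces a∈pieces = ∈∪⁺ (inj₁ (∈∪⁺ (inj₁ (∈∖⁺ (∈⋃⁺ a∈pieces) (∉parts-inner a∉parts)))))
          from-rest : a ∈ rest → a ∈ inner-remainder ∪ discarded ∪ ⋃ thin
          from-rest a∈rest with a ∈? core
          ... | no a∉core = ∈∪⁺ (inj₁ (∈∪⁺ (inj₂ (∈∖⁺ a∈rest a∉core))))
          ... | yes a∈core = [ ⊥-elim ∘ ∉parts-kept a∉parts , ∈∪⁺ ∘ inj₂ ∘ ∈⋃⁺ ]′ (core-split a∈core a∈U)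

      inner-remainder-small : K * ∣ inner-remainder ∣ ≤ u
      inner-remainder-small = ≤-trans Inner.small-remainder (∣∣-mono (⋃-least pieces⊆U))

      thin-small : K * ∣ ⋃ thin ∣ ≤ u
      thin-small = *-cancelʳ-≤ (K * ∣ ⋃ thin ∣) u (suc P) (begin
        K * ∣ ⋃ thin ∣ * suc P    ≡⟨ *-assoc K _ (suc P) ⟩
        K * (∣ ⋃ thin ∣ * suc P)  ≡⟨ cong (K *_) (*-comm ∣ ⋃ thin ∣ (suc P)) ⟩
        K * (suc P * ∣ ⋃ thin ∣)  ≡⟨ *-assoc K (suc P) _ ⟨
        M * ∣ ⋃ thin ∣            ≤⟨ ∣⋃∣≤length* M (All.map (<⇒≤ ∘ ≰⇒>) (Allₚ.all-filter (¬? ∘ large?) candidates)) ⟩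
        length thin * u           ≤⟨ *-monoˡ-≤ u thin-few ⟩
        suc P * u                 ≡⟨ *-comm (suc P) u ⟩
        u * suc P                 ∎)
        where
          open ≤-Reasoning
          thin-few : length thin ≤ suc P
          thin-few = ≤-trans (length-filter (¬? ∘ large?) candidates)
                       (≤-trans (≤-reflexive (length-map (core ∩_) Fs)) (m≤n⇒m≤1+n Fs-few))

      remainder-small : e * ∣ U ∖ ⋃ parts ∣ ≤ u
      remainder-small = begin
        e * ∣ U ∖ ⋃ parts ∣                                       ≤⟨ *-monoʳ-≤ e (∣∣-mono remainder⊆) ⟩
        e * ∣ inner-remainder ∪ discarded ∪ ⋃ thin ∣             ≤⟨ *-monoʳ-≤ e size-of-union ⟩
        e * (∣ inner-remainder ∣ + ∣ discarded ∣ + ∣ ⋃ thin ∣)   ≤⟨ thirds e inner-remainder-small removed-small thin-small ⟩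
        u                                                         ∎
        where
          open ≤-Reasoning
          size-of-union : ∣ inner-remainder ∪ discarded ∪ ⋃ thin ∣ ≤ ∣ inner-remainder ∣ + ∣ discarded ∣ + ∣ ⋃ thin ∣
          size-of-union = ≤-trans (∣∪∣≤ (inner-remainder ∪ discarded) (⋃ thin)) (+-monoˡ-≤ _ (∣∪∣≤ inner-remainder discarded))

      decomposition : Decomposition E Fs N e T
      decomposition = record
        { parts = parts ; few = parts-few ; disjoint = parts-disjoint ; inside = parts-inside
        ; good = parts-good ; small-remainder = remainder-small }

    decompose : ∀ {n} (E : Graph n) Fs → length Fs ≤ P → AllPairs Disjoint Fs → All (¬_ ∘ Shatters E (suc r)) Fs →
      Decomposition E Fs N e T
    decompose E Fs Fs-few Fs-disjoint Fs-rank with 0 <? ∣ ⋃ Fs ∣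
    ... | yes u>0 = decomposition E Fs Fs-few Fs-disjoint Fs-rank u>0
    ... | no u≯0 = trivial-decomposition E (n≤0⇒n≡0 (≮⇒≥ u≯0))

  decompositionBound : ∀ r → DecompositionBound r
  decompositionBound zero P e T T-mono = 0 , λ E Fs _ _ Fs-empty → trivial-decomposition E (n≤0⇒n≡0 (≮⇒≥ λ u>0 →
    let a , a∈⋃Fs = nonempty u>0 in All.lookupWith (λ F-empty a∈F → F-empty (a , a∈F)) Fs-empty (∈⋃⁻ a∈⋃Fs)))
  decompositionBound (suc r) P e T T-mono =
    Step.N r (decompositionBound r) P e T T-mono , Step.decompose r (decompositionBound r) P e T T-mono

module RationalBounds where

  open import Defs using (Graph; Subset; ℕtoℚ; card; nbhdIn; Good)
  import Data.Bool as Bool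
  open import Data.Integer as ℤ using (+_; -[1+_]; +<+)
  import Data.Integer.Properties as ℤ
  open import Data.Nat as ℕ using (ℕ; zero; suc)
  import Data.Nat.Properties as ℕ
  open import Data.Nat.Coprimality using (1-coprimeTo; sym)
  open import Data.Product using (_,_)
  import Data.Sum as Sum
  open import Data.Rational using (ℚ; mkℚ; 0ℚ; 1ℚ; ↧ₙ_; _<_; _+_; _*_; _-_; -_; toℚᵘ; *<*)
  open import Data.Rational.Properties
  open import Data.Rational.Unnormalised as ℚᵘ using (*<*; *≡*)
  import Data.Rational.Unnormalised.Properties as ℚᵘ
  open import Relation.Binary.PropositionalEquality using (_≡_; cong; cong₂; subst; subst₂; trans; module ≡-Reasoning)
    renaming (sym to ≡-sym)
  open FiniteSets
  open SplitTrees using (nbhd)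
  open Decompositions using (Goodℕ)

  ℕtoℚ≡mkℚ : ∀ m → ℕtoℚ m ≡ mkℚ (+ m) 0 (sym (1-coprimeTo m))
  ℕtoℚ≡mkℚ m = normalize-coprime (sym (1-coprimeTo m))

  ℕtoℚ-+ : ∀ x y → ℕtoℚ (x ℕ.+ y) ≡ ℕtoℚ x + ℕtoℚ y
  ℕtoℚ-+ x y = toℚᵘ-injective (ℚᵘ.≃-trans sum (ℚᵘ.≃-sym (toℚᵘ-homo-+ (ℕtoℚ x) (ℕtoℚ y))))
    where
      sum : toℚᵘ (ℕtoℚ (x ℕ.+ y)) ℚᵘ.≃ toℚᵘ (ℕtoℚ x) ℚᵘ.+ toℚᵘ (ℕtoℚ y)
      sum rewrite ℕtoℚ≡mkℚ (x ℕ.+ y) | ℕtoℚ≡mkℚ x | ℕtoℚ≡mkℚ y = *≡* (begin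
        + (x ℕ.+ y) ℤ.* + 1                        ≡⟨ ℤ.*-identityʳ _ ⟩
        + (x ℕ.+ y)                                ≡⟨ ℤ.pos-+ x y ⟩
        + x ℤ.+ + y                                ≡⟨ cong₂ ℤ._+_ (ℤ.*-identityʳ (+ x)) (ℤ.*-identityʳ (+ y)) ⟨
        (+ x ℤ.* + 1 ℤ.+ + y ℤ.* + 1)              ≡⟨ ℤ.*-identityʳ _ ⟨
        (+ x ℤ.* + 1 ℤ.+ + y ℤ.* + 1) ℤ.* + 1      ∎)
        where open ≡-Reasoning

  ℕ<σ*ℕ : ∀ σ → 0ℚ < σ → ∀ x y → ↧ₙ σ ℕ.* x ℕ.< y → ℕtoℚ x < σ * ℕtoℚ y
  ℕ<σ*ℕ σ@(mkℚ (+ suc p) d _) _ x y d*x<y =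
    toℚᵘ-cancel-< (ℚᵘ.<-respʳ-≃ (ℚᵘ.≃-sym (toℚᵘ-homo-* σ (ℕtoℚ y))) unnormalised)
    where
      in-ℕ : x ℕ.* (suc d ℕ.* 1) ℕ.< suc p ℕ.* y ℕ.* 1
      in-ℕ = begin-strict
        x ℕ.* (suc d ℕ.* 1)   ≡⟨ cong (x ℕ.*_) (ℕ.*-identityʳ (suc d)) ⟩
        x ℕ.* suc d           ≡⟨ ℕ.*-comm x (suc d) ⟩
        suc d ℕ.* x           <⟨ d*x<y ⟩
        y                     ≤⟨ ℕ.m≤n*m y (suc p) ⟩
        suc p ℕ.* y           ≡⟨ ℕ.*-identityʳ (suc p ℕ.* y) ⟨
        suc p ℕ.* y ℕ.* 1     ∎
        where open ℕ.≤-Reasoning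
      in-ℤ : + x ℤ.* + (suc d ℕ.* 1) ℤ.< (+ suc p ℤ.* + y) ℤ.* + 1
      in-ℤ = subst₂ ℤ._<_ (ℤ.pos-* x _)
               (trans (ℤ.pos-* (suc p ℕ.* y) 1) (cong (ℤ._* + 1) (ℤ.pos-* (suc p) y))) (+<+ in-ℕ)
      unnormalised : toℚᵘ (ℕtoℚ x) ℚᵘ.< toℚᵘ σ ℚᵘ.* toℚᵘ (ℕtoℚ y)
      unnormalised rewrite ℕtoℚ≡mkℚ x | ℕtoℚ≡mkℚ y = *<* in-ℤ
  ℕ<σ*ℕ (mkℚ (+ zero) _ _) (*<* (+<+ ()))
  ℕ<σ*ℕ (mkℚ -[1+ _ ] _ _) (*<* ())

  [1-σ]*ℕ<ℕ : ∀ σ → 0ℚ < σ → ∀ x z → ↧ₙ σ ℕ.* z ℕ.< x ℕ.+ z → (1ℚ - σ) * ℕtoℚ (x ℕ.+ z) < ℕtoℚ x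
  [1-σ]*ℕ<ℕ σ σ>0 x z d*z<x+z = begin-strict
    (1ℚ - σ) * Y              ≡⟨ *-distribʳ-+ Y 1ℚ (- σ) ⟩
    1ℚ * Y + - σ * Y          ≡⟨ cong₂ _+_ (*-identityˡ Y) (≡-sym (neg-distribˡ-* σ Y)) ⟩
    Y + - (σ * Y)             <⟨ +-monoʳ-< Y (neg-antimono-< (ℕ<σ*ℕ σ σ>0 z (x ℕ.+ z) d*z<x+z)) ⟩
    Y + - ℕtoℚ z              ≡⟨ cong (_- ℕtoℚ z) (ℕtoℚ-+ x z) ⟩
    ℕtoℚ x + ℕtoℚ z - ℕtoℚ z  ≡⟨ +-assoc (ℕtoℚ x) (ℕtoℚ z) (- ℕtoℚ z) ⟩
    ℕtoℚ x + (ℕtoℚ z - ℕtoℚ z) ≡⟨ cong (λ w → ℕtoℚ x + w) (+-inverseʳ (ℕtoℚ z)) ⟩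
    ℕtoℚ x + 0ℚ               ≡⟨ +-identityʳ (ℕtoℚ x) ⟩
    ℕtoℚ x                    ∎
    where
      open ≤-Reasoning
      Y : ℚ
      Y = ℕtoℚ (x ℕ.+ z)

  suc*≤⇒*< : ∀ d z m → suc d ℕ.* z ℕ.≤ m → 0 ℕ.< m → d ℕ.* z ℕ.< m
  suc*≤⇒*< d zero m _ m>0 = ℕ.<-≤-trans (ℕ.≤-reflexive (cong suc (ℕ.*-zeroʳ d))) m>0
  suc*≤⇒*< d (suc z) m bound _ = ℕ.<-≤-trans (ℕ.m<n+m (d ℕ.* suc z) (ℕ.s≤s ℕ.z≤n)) bound

  Goodℕ⇒Good : ∀ {n σ} {E : Graph n} {X Y : Subset n} → 0ℚ < σ → Goodℕ E (↧ₙ σ) X → (∀ a → Y a ≡ X a) → Good σ E Y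
  Goodℕ⇒Good {σ = σ} {E} {X} {Y} σ>0 (_ , balanced) Y≗X b = Sum.map few-neighbours few-non-neighbours (balanced b)
    where
      size : card Y ≡ ∣ X ∣
      size = trans (card≡∣∣ Y) (∣∣-≗ Y≗X)
      size-nbhd : card (nbhdIn E Y b) ≡ ∣ X ∩ nbhd E b ∣
      size-nbhd = trans (card≡∣∣ _) (∣∣-≗ λ a → trans (cong (Bool._∧ E a b) (Y≗X a)) (≡-sym (∩-apply X (nbhd E b) a)))
      few-neighbours : ↧ₙ σ ℕ.* ∣ X ∩ nbhd E b ∣ ℕ.< ∣ X ∣ → ℕtoℚ (card (nbhdIn E Y b)) < σ * ℕtoℚ (card Y)
      few-neighbours bound = subst₂ (λ s t → ℕtoℚ s < σ * ℕtoℚ t) (≡-sym size-nbhd) (≡-sym size) (ℕ<σ*ℕ σ σ>0 _ _ bound)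
      few-non-neighbours : ↧ₙ σ ℕ.* ∣ X ∖ nbhd E b ∣ ℕ.< ∣ X ∣ → (1ℚ - σ) * ℕtoℚ (card Y) < ℕtoℚ (card (nbhdIn E Y b))
      few-non-neighbours bound =
        subst₂ (λ s t → (1ℚ - σ) * ℕtoℚ t < ℕtoℚ s) (≡-sym size-nbhd) (trans (≡-sym (∣∣-split X (nbhd E b))) (≡-sym size))
          ([1-σ]*ℕ<ℕ σ σ>0 _ _ (subst (ℕ._<_ _) (∣∣-split X (nbhd E b)) bound))

module Labelling where

  open import Defs using (Subset; part)
  open import Data.Bool using (true; false; T; if_then_else_)
  open import Data.Empty using (⊥-elim)
  open import Data.Unit using (tt)
  open import Data.Fin using (Fin; zero; suc; punchIn; _≟_)
  open import Data.List using (List; []; _∷_; length; lookup)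
  open import Data.List.Membership.Propositional.Properties using (∈-lookup)
  open import Data.List.Relation.Unary.All as All using ()
  open import Data.List.Relation.Unary.AllPairs using (AllPairs; _∷_)
  open import Data.List.Relation.Unary.Any using (Any; here; there)
  open import Data.Nat as ℕ using (ℕ)
  open import Relation.Nullary using (does; yes)
  open import Relation.Binary.PropositionalEquality using (_≡_; _≢_; refl; sym; trans; subst)
  open FiniteSets

  label : ∀ {n} (Xs : List (Subset n)) → Fin n → Fin (ℕ.suc (length Xs))
  label [] a = zero
  label (X ∷ Xs) a = if X a then suc zero else punchIn (suc zero) (label Xs a)

  private variable
    n : ℕ
    a : Fin n

  ∈part⇒ : ∀ {m} {f : Fin n → Fin m} {i} → a ∈ part f i → f a ≡ i
  ∈part⇒ {a = a} {f = f} {i} a∈part with f a ≟ i | ∈⇒T a∈part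
  ... | yes fa≡i | _ = fa≡i

  label≢zero : ∀ (Xs : List (Subset n)) → Any (a ∈_) Xs → label Xs a ≢ zero
  label≢zero {a = a} (X ∷ Xs) a∈Xs with X a in Xa | a∈Xs
  ... | true | _ = λ ()
  ... | false | here a∈X = ⊥-elim (subst T Xa (∈⇒T a∈X))
  ... | false | there a∈Xs′ = λ shifted≡zero → label≢zero Xs a∈Xs′ (punchIn₁≡zero shifted≡zero)
    where
      punchIn₁≡zero : ∀ {k} {j : Fin (ℕ.suc k)} → punchIn (suc zero) j ≡ zero → j ≡ zero
      punchIn₁≡zero {j = zero} _ = refl

  unlabelled∉⋃ : ∀ (Xs : List (Subset n)) → a ∈ part (label Xs) zero → a ∉ ⋃ Xs
  unlabelled∉⋃ Xs a∈unlabelled a∈⋃ = label≢zero Xs (∈⋃⁻ a∈⋃) (∈part⇒ {f = label Xs} a∈unlabelled)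

  labelled≗lookup : ∀ (Xs : List (Subset n)) → AllPairs Disjoint Xs → ∀ i a → part (label Xs) (suc i) a ≡ lookup Xs i a
  labelled≗lookup (X ∷ Xs) _ zero a with X a
  ... | true = refl
  ... | false = punchIn₁≢one (label Xs a)
    where
      punchIn₁≢one : ∀ {k} (j : Fin (ℕ.suc k)) → does (punchIn (suc zero) j ≟ suc zero) ≡ false
      punchIn₁≢one zero = refl
      punchIn₁≢one (suc j) = refl
  labelled≗lookup (X ∷ Xs) (X#Xs ∷ disjoint) (suc i) a with X a in Xa
  ... | true = sym (∉⇒false (All.lookup X#Xs (∈-lookup i) (T⇒∈ X (subst T (sym Xa) tt))))
  ... | false = trans (punchIn₁-≟ (label Xs a)) (labelled≗lookup Xs disjoint i a)
    where
      punchIn₁-≟ : (j : Fin (ℕ.suc (length Xs))) → does (punchIn (suc zero) j ≟ suc (suc i)) ≡ does (j ≟ suc i)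
      punchIn₁-≟ zero = refl
      punchIn₁-≟ (suc j) = refl

open import Defs
open import Data.Nat using (ℕ; suc; _≤_)
import Data.Nat as ℕ
open import Data.Nat.Properties using (≤-refl; *-monoʳ-≤; module ≤-Reasoning)
open import Data.Fin using (Fin; zero; suc)
open import Data.Rational using (ℚ; 0ℚ; 1ℚ; _<_; _*_; ↧ₙ_)
open import Data.Product using (Σ; _×_; _,_; proj₁)
open import Data.Sum using (inj₁)
open import Data.List using ([]; _∷_; length)
open import Data.List.Membership.Propositional.Properties using (∈-lookup)
open import Data.List.Relation.Unary.All as All using ([]; _∷_)
open import Data.List.Relation.Unary.AllPairs using ([]; _∷_)
open import Function using (_∘_)
open import Relation.Binary.PropositionalEquality using (cong)
open FiniteSets
open SplitTrees
open Decompositions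
open RunningMaximum
open RationalBounds
open Labelling

partition : ∀ {n N} {E : Graph n} (ε : ℚ) (σ : ℕ → ℚ) → 0ℚ < ε → (∀ m → 0ℚ < σ m) → 1 ≤ n →
  Decomposition E (full ∷ []) N (suc (↧ₙ ε)) (maxUpTo (↧ₙ_ ∘ σ)) →
  Σ ℕ λ m → m ≤ N × Σ (Fin n → Fin (suc m)) λ f →
    (ℕtoℚ (card (part f zero)) < ε * ℕtoℚ n) × ((i : Fin m) → Good (σ m) E (part f (suc i)))
partition {n} {E = E} ε σ ε>0 σ>0 n≥1 D = length parts , few , label parts , unlabelled-small , labelled-good
  where
    open Decomposition D

    unlabelled⊆ : part (label parts) zero ⊆ ⋃ (full ∷ []) ∖ ⋃ parts
    unlabelled⊆ a∈unlabelled = ∈∖⁺ (∈∪⁺ (inj₁ ∈full)) (unlabelled∉⋃ parts a∈unlabelled)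

    unlabelled-small : ℕtoℚ (card (part (label parts) zero)) < ε * ℕtoℚ n
    unlabelled-small = ℕ<σ*ℕ ε ε>0 (card (part (label parts) zero)) n (suc*≤⇒*< (↧ₙ ε) _ n (begin
      suc (↧ₙ ε) ℕ.* card (part (label parts) zero)   ≡⟨ cong (suc (↧ₙ ε) ℕ.*_) (card≡∣∣ _) ⟩
      suc (↧ₙ ε) ℕ.* ∣ part (label parts) zero ∣      ≤⟨ *-monoʳ-≤ (suc (↧ₙ ε)) (∣∣-mono unlabelled⊆) ⟩
      suc (↧ₙ ε) ℕ.* ∣ ⋃ (full ∷ []) ∖ ⋃ parts ∣      ≤⟨ small-remainder ⟩
      ∣ full ∪ ∅ ∣                                   ≡⟨ ∣∣-cong (λ _ → ∈full) (∈∪⁺ ∘ inj₁) ⟩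
      ∣ full ∣                                       ≡⟨ ∣full∣ n ⟩
      n                                              ∎) n≥1)
      where open ≤-Reasoning

    labelled-good : (i : Fin (length parts)) → Good (σ (length parts)) E (part (label parts) (suc i))
    labelled-good i = Goodℕ⇒Good (σ>0 _)
      (Goodℕ-anti E (≤-maxUpTo (↧ₙ_ ∘ σ) ≤-refl) (All.lookup good (∈-lookup i))) (labelled≗lookup parts disjoint i)

lemma3p8 : (k : ℕ) → 1 ≤ k → (ε : ℚ) → 0ℚ < ε → (σ : ℕ → ℚ) → ((m : ℕ) → (0ℚ < σ m) × (σ m < 1ℚ)) →
    Σ ℕ λ N → (n : ℕ) → 1 ≤ n → (E : Graph n) → Symmetric E → Irreflexive E → Stable k E →
      Σ ℕ λ m → m ≤ N × Σ (Fin n → Fin (suc m)) λ f →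
        (ℕtoℚ (card (part f zero)) < ε * ℕtoℚ n)
        × ((i : Fin m) → Good (σ m) E (part f (suc i)))
lemma3p8 k _ ε ε>0 σ σ-bounds
  with decompositionBound (ladderDepth k (suc k)) 1 (suc (↧ₙ ε)) (maxUpTo (↧ₙ_ ∘ σ)) (maxUpTo-mono _)
... | N , decompose = N , λ n n≥1 E symmetric _ stable →
  partition ε σ ε>0 (proj₁ ∘ σ-bounds) n≥1
    (decompose E (full ∷ []) ≤-refl ([] ∷ []) (stable⇒¬Shatters E symmetric k stable ∷ []))
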